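{- Let $n\ge2$, let $P,Q$ be finite posets with $|P|=p$, $|Q|=q$, let $D_\lambda=C_{\lambda_1}+\cdots+C_{\lambda_\ell}\in\mathfrak{D}_n$ (so $\ell\ge2$), let $R=P\oplus D_\lambda\oplus Q$, and let $1\le i$, $i+1<j<k\le p+n+q$. Suppose $w$ is a permutation of $\{1,\ldots,n\}$ such that for every linear extension $f$ of $R$, the ordered set partition of $I((t_iq_{jk})^2(f))$ equals $(w(L_1),\ldots,w(L_\ell))$, where $(L_1,\ldots,L_\ell)$ is the ordered set partition of $I(f)$. Then $(t_iq_{jk})^2(f)$ agrees with $f$ on $D_\lambda$ for every linear extension $f$ of $R$ if and only if $w$ is the identity permutation.
   Context: For a finite poset $X$ with $|X|=N$, a linear extension is a bijection $f:X\to\{1,\ldots,N\}$ with $f(a)<f(b)$ whenever $a<_X b$. For $1\le i\le N-1$ the Bender–Knuth involution $t_i$ swaps labels $i$ and $i+1$ if $f^{ -1}(i)$, $f^{ -1}(i+1)$ are incomparable, and does nothing otherwise. Products denote composition, rightmost first. $q_0=\mathrm{id}$, $q_i=t_1(t_2t_1)\cdots(t_it_{i-1}\cdots t_1)$, $q_{jk}=q_{k-1}q_{k-j}q_{k-1}$. $X\oplus Y$: ordinal sum (all of $X$ below all of $Y$); $+$: disjoint union; $C_m$: $m$-element chain. For $n>1$, $\mathfrak{D}_n$ is the set of posets $C_{\lambda_1}+\cdots+C_{\lambda_\ell}$ with $\lambda\vdash n$, $\ell>1$. For a linear extension $f$ of $R$, $I(f)$ is the linear extension of $D_\lambda$ given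 by $I(f)(x)=f(x)-p$. The ordered set partition of a linear extension $g$ of $D_\lambda=C_{\lambda_1}+\cdots+C_{\lambda_\ell}$ is $(g(C_{\lambda_1}),\ldots,g(C_{\lambda_\ell}))$, an ordered partition of $\{1,\ldots,n\}$ that determines $g$. -}

module Defs where

open import Level using (0ℓ)
open import Data.Bool using (Bool; true; false; if_then_else_; not; _∨_)
open import Data.Nat using (ℕ; zero; suc; _+_; _∸_; _≤_; _<_; _≟_; _<?_)
open import Data.Fin as F using (Fin; toℕ)
open import Data.Fin.Properties as FP using ()
open import Data.Vec using (Vec; lookup; sum)
open import Data.List using (List; []; _∷_; map; _++_; concatMap; allFin)
open import Data.Maybe using (Maybe; just; nothing)
open import Data.Product using (_×_; _,_; ∃-syntax)
open import Data.Unit using (⊤; tt)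
open import Data.Empty using (⊥)
open import Function using (_∘_; id)
open import Relation.Nullary using (Dec; yes; no; ¬_)
open import Relation.Nullary.Decidable using (⌊_⌋; _×-dec_)
open import Relation.Binary using (Rel; Decidable; IsDecStrictPartialOrder)
open import Relation.Binary.PropositionalEquality using (_≡_)

module BK {A : Set} (elems : List A) {_≺_ : Rel A 0ℓ} (_≺?_ : Decidable _≺_) where

  inv : (A → ℕ) → ℕ → Maybe A
  inv f k = go elems
    where
    go : List A → Maybe A
    go []       = nothing
    go (x ∷ xs) = if ⌊ f x ≟ k ⌋ then just x else go xs

  swappable : (A → ℕ) → ℕ → Bool
  swappable f i with inv f i | inv f (suc i)
  ... | just a | just b = not (⌊ a ≺? b ⌋ ∨ ⌊ b ≺? a ⌋)
  ... | _      | _      = false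

  t : ℕ → (A → ℕ) → (A → ℕ)
  t i f x =
    if ⌊ f x ≟ i ⌋ then (if swappable f i then suc i else f x)
    else if ⌊ f x ≟ suc i ⌋ then (if swappable f i then i else f x)
    else f x

  tdown : ℕ → (A → ℕ) → (A → ℕ)
  tdown zero    = id
  tdown (suc i) = t (suc i) ∘ tdown i

  -- q_0 = id, q_i = t_1 (t_2 t_1) ⋯ (t_i ⋯ t_1) = q_{i-1} (t_i ⋯ t_1)
  q : ℕ → (A → ℕ) → (A → ℕ)
  q zero    = id
  q (suc i) = q i ∘ tdown (suc i)

  qq : ℕ → ℕ → (A → ℕ) → (A → ℕ)
  qq j k = q (k ∸ 1) ∘ q (k ∸ j) ∘ q (k ∸ 1)

  IsLinExt : ℕ → (A → ℕ) → Set
  IsLinExt N f =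
    (∀ x y → f x ≡ f y → x ≡ y) ×
    (∀ x → 1 ≤ f x × f x ≤ N) ×
    (∀ m → 1 ≤ m → m ≤ N → ∃[ x ] f x ≡ m) ×
    (∀ x y → x ≺ y → f x < f y)

IsDPartition : (n ℓ : ℕ) → Vec ℕ ℓ → Set
IsDPartition n ℓ lam =
  (2 ≤ ℓ) ×
  (∀ (c : Fin ℓ) → 1 ≤ lookup lam c) ×
  (∀ (a b : Fin ℓ) → a F.≤ b → lookup lam b ≤ lookup lam a) ×
  (sum lam ≡ n)

-- The poset R = P ⊕ D_λ ⊕ Q, with D_λ = C_{λ_1} + ⋯ + C_{λ_ℓ}.
-- Element (c , r) of D_λ is the r-th element (0-based) of chain C_{λ_c}.

data RElt (p q ℓ : ℕ) (lam : Vec ℕ ℓ) : Set where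
  inP : Fin p → RElt p q ℓ lam
  inD : (c : Fin ℓ) → Fin (lookup lam c) → RElt p q ℓ lam
  inQ : Fin q → RElt p q ℓ lam

module Rposet {p q ℓ : ℕ} {lam : Vec ℕ ℓ}
  {_<P_ : Rel (Fin p) 0ℓ} (Pp : IsDecStrictPartialOrder _≡_ _<P_)
  {_<Q_ : Rel (Fin q) 0ℓ} (Qp : IsDecStrictPartialOrder _≡_ _<Q_) where

  R : Set
  R = RElt p q ℓ lam

  elemsR : List R
  elemsR = map inP (allFin p)
        ++ concatMap (λ c → map (inD c) (allFin (lookup lam c))) (allFin ℓ)
        ++ map inQ (allFin q)

  _<R_ : Rel R 0ℓ
  inP a   <R inP b    = a <P b
  inP _   <R inD _ _  = ⊤
  inP _   <R inQ _    = ⊤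
  inD c r <R inD c' r' = (c ≡ c') × (toℕ r < toℕ r')
  inD _ _ <R inQ _    = ⊤
  inQ a   <R inQ b    = a <Q b
  _       <R _        = ⊥

  _<R?_ : Decidable _<R_
  inP a   <R? inP b    = IsDecStrictPartialOrder._<?_ Pp a b
  inP _   <R? inD _ _  = yes tt
  inP _   <R? inQ _    = yes tt
  inD c r <R? inD c' r' = (c FP.≟ c') ×-dec (toℕ r <? toℕ r')
  inD _ _ <R? inQ _    = yes tt
  inQ a   <R? inQ b    = IsDecStrictPartialOrder._<?_ Qp a b
  inD _ _ <R? inP _    = no (λ ())
  inQ _   <R? inP _    = no (λ ())
  inQ _   <R? inD _ _  = no (λ ())

  open BK elemsR _<R?_ public

  F : ℕ → ℕ → ℕ → (R → ℕ) → (R → ℕ)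
  F i j k = t i ∘ qq j k ∘ t i ∘ qq j k

  I : (R → ℕ) → (c : Fin ℓ) → Fin (lookup lam c) → ℕ
  I f c r = f (inD c r) ∸ p

-- c-th block g(C_{λ_c}) of the ordered set partition of g, as a set of labels
block : ∀ {ℓ} {lam : Vec ℕ ℓ} → ((c : Fin ℓ) → Fin (lookup lam c) → ℕ) → Fin ℓ → ℕ → Set
block {lam = lam} g c m = ∃[ r ] g c r ≡ m

image : (ℕ → ℕ) → (ℕ → Set) → ℕ → Set
image w S m = ∃[ m′ ] (S m′ × w m′ ≡ m)

IsPermOn : ℕ → (ℕ → ℕ) → Set
IsPermOn n w =
  (∀ m → 1 ≤ m → m ≤ n → 1 ≤ w m × w m ≤ n) ×
  (∀ a b → 1 ≤ a → a ≤ n → 1 ≤ b → b ≤ n → w a ≡ w b → a ≡ b) ×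
  (∀ m → 1 ≤ m → m ≤ n → ∃[ a ] (1 ≤ a × a ≤ n × w a ≡ m))

{-# OPTIONS --safe #-}
-- A Bender–Knuth involution t_i swaps the labels i and i + 1 only when their
-- preimages are incomparable, so it maps injective order-preserving labellings
-- to such labellings; hence so does F = (t_i q_jk)², and F f is increasing along
-- every chain of D_λ.  If w fixes {1, …, n}, the hypothesis says that F f and f
-- give each chain the same set of labels; two increasing labellings of a chain
-- with the same image coincide, so F f = f on D_λ.  Conversely, if w m ≠ m, take
-- a linear extension f of R putting m and w m (shifted by p) on different chains
-- c ≠ d, which exists because ℓ ≥ 2: the hypothesis puts w m into F f(C_c), which
-- equals f(C_c) if F f = f on D_λ, contradicting the injectivity of f.
module Submission where

open import Defs
open import Level using (0ℓ)
open import Data.Bool using (Bool; true; false; if_then_else_)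
open import Data.Nat using (ℕ; zero; suc; _+_; _∸_; _≤_; _<_; z≤n; s≤s; _≟_; _<?_; _≤?_)
open import Data.Nat.Properties
open import Data.Fin as F using (Fin; toℕ; fromℕ<; combine)
import Data.Fin.Properties as FP
import Data.Fin.Induction as FI
open import Data.Vec using (Vec; []; _∷_; lookup; sum)
open import Data.List using (List; []; _∷_; length; allFin)
open import Data.List.Properties using (length-tabulate)
open import Data.List.Membership.Propositional using (_∈_)
open import Data.List.Membership.Propositional.Properties using (∈-allFin)
open import Data.List.Relation.Unary.Any using (here; there)
open import Data.Maybe using (just; nothing)
open import Data.Product using (_×_; _,_; ∃-syntax; proj₁; proj₂)
open import Data.Sum using (_⊎_; inj₁; inj₂; [_,_]′)
open import Data.Empty using (⊥-elim)
open import Data.Unit using (tt)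
open import Function using (_∘_; id)
open import Function.Definitions using (Injective)
open import Function.Bundles using (_⇔_; mk⇔; Equivalence)
import Function.Properties.Equivalence as ⇔
open import Induction.WellFounded using (module All)
open import Relation.Nullary using (Dec; yes; no; ¬_; contradiction)
open import Relation.Nullary.Decidable using (⌊_⌋; decidable-stable)
open import Relation.Binary using (Rel; Decidable; IsDecStrictPartialOrder; tri<; tri≈; tri>)
open import Relation.Binary.PropositionalEquality

-- Counting and linear extensions of finite posets

count : {A : Set} {P : A → Set} → (∀ x → Dec (P x)) → List A → ℕ
count P? []       = 0
count P? (x ∷ xs) with P? x
... | yes _ = suc (count P? xs)
... | no  _ = count P? xs

module _ {A : Set} {P : A → Set} (P? : ∀ x → Dec (P x)) where

  count≤length : ∀ xs → count P? xs ≤ length xs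
  count≤length []       = z≤n
  count≤length (x ∷ xs) with P? x
  ... | yes _ = s≤s (count≤length xs)
  ... | no  _ = m≤n⇒m≤1+n (count≤length xs)

  count<length : ∀ {x} xs → x ∈ xs → ¬ P x → count P? xs < length xs
  count<length (x ∷ xs) (here refl) ¬px with P? x
  ... | yes px = contradiction px ¬px
  ... | no  _  = s≤s (count≤length xs)
  count<length (y ∷ xs) (there x∈xs) ¬px with P? y
  ... | yes _ = s≤s (count<length xs x∈xs ¬px)
  ... | no  _ = m≤n⇒m≤1+n (count<length xs x∈xs ¬px)

module _ {A : Set} {P Q : A → Set} (P? : ∀ x → Dec (P x)) (Q? : ∀ x → Dec (Q x))
         (P⊆Q : ∀ {x} → P x → Q x) where

  count-mono : ∀ xs → count P? xs ≤ count Q? xs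
  count-mono []       = z≤n
  count-mono (x ∷ xs) with P? x | Q? x
  ... | yes _  | yes _  = s≤s (count-mono xs)
  ... | yes px | no ¬qx = contradiction (P⊆Q px) ¬qx
  ... | no _   | yes _  = m≤n⇒m≤1+n (count-mono xs)
  ... | no _   | no _   = count-mono xs

  count-mono-< : ∀ {x} xs → x ∈ xs → ¬ P x → Q x → count P? xs < count Q? xs
  count-mono-< (x ∷ xs) (here refl) ¬px qx with P? x | Q? x
  ... | yes px | _      = contradiction px ¬px
  ... | no _   | yes _  = s≤s (count-mono xs)
  ... | no _   | no ¬qx = contradiction qx ¬qx
  count-mono-< (y ∷ xs) (there x∈xs) ¬px qx with P? y | Q? y
  ... | yes _  | yes _  = s≤s (count-mono-< xs x∈xs ¬px qx)
  ... | yes py | no ¬qy = contradiction (P⊆Q py) ¬qy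
  ... | no _   | yes _  = m≤n⇒m≤1+n (count-mono-< xs x∈xs ¬px qx)
  ... | no _   | no _   = count-mono-< xs x∈xs ¬px qx

length-allFin : ∀ p → length (allFin p) ≡ p
length-allFin p = length-tabulate id

injective⇒surjective : ∀ {p} (h : Fin p → Fin p) → Injective _≡_ _≡_ h → ∀ v → ∃[ a ] h a ≡ v
injective⇒surjective {suc p} h h-inj v with FP.any? (λ a → h a FP.≟ v)
... | yes hit = hit
... | no miss = contradiction (FP.injective⇒≤ h′-inj) (<-irrefl refl)
  where
  h≢v : ∀ a → v ≢ h a
  h≢v a v≡ha = miss (a , sym v≡ha)
  h′ : Fin (suc p) → Fin p
  h′ a = F.punchOut (h≢v a)
  h′-inj : ∀ {a b} → h′ a ≡ h′ b → a ≡ b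
  h′-inj {a} {b} eq = h-inj (FP.punchOut-injective (h≢v a) (h≢v b) eq)

bounded-injective⇒surjective : ∀ {p} (h : Fin p → ℕ) (h< : ∀ a → h a < p) → Injective _≡_ _≡_ h →
                               ∀ m → m < p → ∃[ a ] h a ≡ m
bounded-injective⇒surjective h h< h-inj m m<p
  with injective⇒surjective (λ a → fromℕ< (h< a)) fin-inj (fromℕ< m<p)
  where
  fin-inj : Injective _≡_ _≡_ (λ a → fromℕ< (h< a))
  fin-inj {a} {b} eq = h-inj (FP.fromℕ<-injective _ _ (h< a) (h< b) eq)
... | a , eq = a , FP.fromℕ<-injective _ _ (h< a) m<p eq

-- Linear extensions labelled 0, …, N − 1 (those of Defs are labelled 1, …, N).
record IsLinExt₀ {A : Set} (_≺_ : Rel A 0ℓ) (N : ℕ) (h : A → ℕ) : Set where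
  field
    injective  : Injective _≡_ _≡_ h
    bounded    : ∀ x → h x < N
    surjective : ∀ m → m < N → ∃[ x ] h x ≡ m
    monotone   : ∀ x y → x ≺ y → h x < h y

module Rank {p : ℕ} (key : Fin p → ℕ) (key-injective : Injective _≡_ _≡_ key) where

  rank : Fin p → ℕ
  rank x = count (λ y → key y <? key x) (allFin p)

  rank-mono : ∀ x y → key x < key y → rank x < rank y
  rank-mono x y kx<ky =
    count-mono-< (λ z → key z <? key x) (λ z → key z <? key y) (λ kz<kx → <-trans kz<kx kx<ky)
                 (allFin p) (∈-allFin x) (<-irrefl refl) kx<ky

  rank<p : ∀ x → rank x < p
  rank<p x = subst (rank x <_) (length-allFin p)
                   (count<length (λ y → key y <? key x) (allFin p) (∈-allFin x) (<-irrefl refl))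

  rank-injective : Injective _≡_ _≡_ rank
  rank-injective {x} {y} eq with <-cmp (key x) (key y)
  ... | tri< kx<ky _ _ = contradiction eq (<⇒≢ (rank-mono x y kx<ky))
  ... | tri≈ _ kx≡ky _ = key-injective kx≡ky
  ... | tri> _ _ ky<kx = contradiction (sym eq) (<⇒≢ (rank-mono y x ky<kx))

  rank-linExt₀ : {_≺_ : Rel (Fin p) 0ℓ} → (∀ x y → x ≺ y → key x < key y) →
                 IsLinExt₀ _≺_ p rank
  rank-linExt₀ key-mono = record
    { injective  = rank-injective
    ; bounded    = rank<p
    ; surjective = bounded-injective⇒surjective rank rank<p rank-injective
    ; monotone   = λ x y x≺y → rank-mono x y (key-mono x y x≺y)
    }

module _ {p : ℕ} {_<P_ : Rel (Fin p) 0ℓ} (Pp : IsDecStrictPartialOrder _≡_ _<P_) where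
  open IsDecStrictPartialOrder Pp using () renaming (_<?_ to _<P?_; irrefl to <P-irrefl; trans to <P-trans)

  private
    depth : Fin p → ℕ
    depth x = count (_<P? x) (allFin p)

    depth<p : ∀ x → depth x < p
    depth<p x = subst (depth x <_) (length-allFin p) (count<length (_<P? x) (allFin p) (∈-allFin x) (<P-irrefl refl))

    depth-mono : ∀ x y → x <P y → depth x < depth y
    depth-mono x y x<y = count-mono-< (_<P? x) (_<P? y) (λ z<x → <P-trans z<x x<y)
                                      (allFin p) (∈-allFin x) (<P-irrefl refl) x<y

    -- depth first, ties broken by the index
    key : Fin p → ℕ
    key x = toℕ (combine (fromℕ< (depth<p x)) x)

    key-injective : Injective _≡_ _≡_ key
    key-injective {x} {y} eq =
      FP.combine-injectiveʳ (fromℕ< (depth<p x)) x (fromℕ< (depth<p y)) y (FP.toℕ-injective eq)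

    key-mono : ∀ x y → x <P y → key x < key y
    key-mono x y x<y = FP.combine-monoˡ-< x y
      (subst₂ _<_ (sym (FP.toℕ-fromℕ< (depth<p x))) (sym (FP.toℕ-fromℕ< (depth<p y))) (depth-mono x y x<y))

  linExt₀-exists : ∃[ h ] IsLinExt₀ _<P_ p h
  linExt₀-exists = Rank.rank key key-injective , Rank.rank-linExt₀ key key-injective key-mono

injective⇒≤-interval : ∀ {m} (h : Fin m → ℕ) {lo hi} → lo ≤ hi → Injective _≡_ _≡_ h →
                       (∀ a → lo ≤ h a) → (∀ a → h a < hi) → lo + m ≤ hi
injective⇒≤-interval {m} h {lo} {hi} lo≤hi h-inj lo≤h h<hi =
  subst (lo + m ≤_) (m+[n∸m]≡n lo≤hi) (+-monoʳ-≤ lo (FP.injective⇒≤ h′-inj))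
  where
  h∸lo< : ∀ a → h a ∸ lo < hi ∸ lo
  h∸lo< a = ∸-monoˡ-< (h<hi a) (lo≤h a)
  h′ : Fin m → Fin (hi ∸ lo)
  h′ a = fromℕ< (h∸lo< a)
  h′-inj : ∀ {a b} → h′ a ≡ h′ b → a ≡ b
  h′-inj {a} {b} eq = h-inj (∸-cancelʳ-≡ (lo≤h a) (lo≤h b) (FP.fromℕ<-injective _ _ (h∸lo< a) (h∸lo< b) eq))

StrictlyIncreasing : ∀ {L} → (Fin L → ℕ) → Set
StrictlyIncreasing h = ∀ {r r′} → r F.< r′ → h r < h r′

private
  ≤-at-first-disagreement : ∀ {L} {h k : Fin L → ℕ} → StrictlyIncreasing h → StrictlyIncreasing k →
    ∀ r → (∀ {r′} → r′ F.< r → h r′ ≡ k r′) → ∃[ r″ ] h r″ ≡ k r → h r ≤ k r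
  ≤-at-first-disagreement {h = h} h↑ k↑ r agree (r″ , hr″≡kr) with FP.<-cmp r r″
  ... | tri< r<r″ _ _ = subst (h r ≤_) hr″≡kr (<⇒≤ (h↑ r<r″))
  ... | tri≈ _ refl _ = ≤-reflexive hr″≡kr
  ... | tri> _ _ r″<r = contradiction (trans (sym (agree r″<r)) hr″≡kr) (<⇒≢ (k↑ r″<r))

increasing-image-unique : ∀ {L} {h k : Fin L → ℕ} → StrictlyIncreasing h → StrictlyIncreasing k →
  (∀ m → (∃[ r ] h r ≡ m) ⇔ (∃[ r ] k r ≡ m)) → ∀ r → h r ≡ k r
increasing-image-unique {h = h} {k} h↑ k↑ same-image = All.wfRec FI.<-wellFounded 0ℓ (λ r → h r ≡ k r)
  λ r agree → ≤-antisym (≤-at-first-disagreement h↑ k↑ r agree (Equivalence.from (same-image (k r)) (r , refl)))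
                        (≤-at-first-disagreement k↑ h↑ r (sym ∘ agree) (Equivalence.to (same-image (h r)) (r , refl)))

image-of-fixed : ∀ {w : ℕ → ℕ} {S : ℕ → Set} → (∀ m → S m → w m ≡ m) → ∀ m → image w S m ⇔ S m
image-of-fixed fixed m = mk⇔ (λ (m′ , Sm′ , wm′≡m) → subst _ (trans (sym (fixed m′ Sm′)) wm′≡m) Sm′)
                             (λ Sm → m , Sm , fixed m Sm)

strictMono⇒injective : ∀ {h : ℕ → ℕ} → (∀ {u v} → u < v → h u < h v) → ∀ {u v} → h u ≡ h v → u ≡ v
strictMono⇒injective h-mono {u} {v} eq with <-cmp u v
... | tri< u<v _ _ = contradiction eq (<⇒≢ (h-mono u<v))
... | tri≈ _ u≡v _ = u≡v
... | tri> _ _ v<u = contradiction (sym eq) (<⇒≢ (h-mono v<u))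

m≤n+o⇒m∸o≤n : ∀ m n o → m ≤ n + o → m ∸ o ≤ n
m≤n+o⇒m∸o≤n m n o m≤n+o = m≤n+o⇒m∸n≤o m o (subst (m ≤_) (+-comm n o) m≤n+o)

m≤n⇒n<m+o⇒n∸m<o : ∀ {m n o} → m ≤ n → n < m + o → n ∸ m < o
m≤n⇒n<m+o⇒n∸m<o {m} {n} {o} m≤n n<m+o = subst (n ∸ m <_) (m+n∸m≡n m o) (∸-monoˡ-< n<m+o m≤n)

-- Linear extensions of D_λ separating two labels

record DElt {ℓ} (lam : Vec ℕ ℓ) : Set where
  constructor _,_
  field
    chain : Fin ℓ
    pos   : Fin (lookup lam chain)

_≺D_ : ∀ {ℓ} {lam : Vec ℕ ℓ} → Rel (DElt lam) 0ℓ
(c , r) ≺D (c′ , r′) = c ≡ c′ × toℕ r < toℕ r′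

IsLinExtD : ∀ {ℓ} (lam : Vec ℕ ℓ) → (DElt lam → ℕ) → Set
IsLinExtD lam = IsLinExt₀ _≺D_ (sum lam)

-- The increasing enumeration of ℕ ∖ [s, s + m).
skip : ℕ → ℕ → ℕ → ℕ
skip s m v with v <? s
... | yes _ = v
... | no  _ = v + m

skip-below : ∀ {s} m {v} → v < s → skip s m v ≡ v
skip-below {s} m {v} v<s with v <? s
... | yes _   = refl
... | no  v≮s = contradiction v<s v≮s

skip-above : ∀ {s} m {v} → s ≤ v → skip s m v ≡ v + m
skip-above {s} m {v} s≤v with v <? s
... | yes v<s = contradiction s≤v (<⇒≱ v<s)
... | no  _   = refl

skip-cases : ∀ s m v → (v < s × skip s m v ≡ v) ⊎ (s ≤ v × skip s m v ≡ v + m)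
skip-cases s m v with v <? s
... | yes v<s = inj₁ (v<s , refl)
... | no  v≮s = inj₂ (≮⇒≥ v≮s , refl)

skip-outside : ∀ s m v → skip s m v < s ⊎ s + m ≤ skip s m v
skip-outside s m v with skip-cases s m v
... | inj₁ (v<s , eq) = inj₁ (subst (_< s) (sym eq) v<s)
... | inj₂ (s≤v , eq) = inj₂ (subst (s + m ≤_) (sym eq) (+-monoˡ-≤ m s≤v))

skip-mono-< : ∀ s m {u v} → u < v → skip s m u < skip s m v
skip-mono-< s m {u} {v} u<v with skip-cases s m u | skip-cases s m v
... | inj₁ (_ , eu)   | inj₁ (_ , ev)   = subst₂ _<_ (sym eu) (sym ev) u<v
... | inj₁ (_ , eu)   | inj₂ (_ , ev)   = subst₂ _<_ (sym eu) (sym ev) (<-≤-trans u<v (m≤m+n v m))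
... | inj₂ (s≤u , _)  | inj₁ (v<s , _)  = contradiction (<-trans u<v v<s) (≤⇒≯ s≤u)
... | inj₂ (_ , eu)   | inj₂ (_ , ev)   = subst₂ _<_ (sym eu) (sym ev) (+-monoˡ-< m u<v)

module Splice {ℓ} (x s : ℕ) {xs : Vec ℕ ℓ} (h : DElt xs → ℕ) where

  m : ℕ
  m = sum xs

  -- Chains 1, 2, … are labelled by h shifted into the window [s, s + m);
  -- chain 0 takes the labels below and above the window.
  splice : DElt (x ∷ xs) → ℕ
  splice (F.zero  , r) = skip s m (toℕ r)
  splice (F.suc c , r) = s + h (c , r)

  module _ (s≤x : s ≤ x) (H : IsLinExtD xs h) where
    private module H = IsLinExt₀ H

    splice-below : ∀ {v} → v < s → ∃[ r ] splice (F.zero , r) ≡ v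
    splice-below {v} v<s = fromℕ< (<-≤-trans v<s s≤x) ,
      trans (cong (skip s m) (FP.toℕ-fromℕ< _)) (skip-below m v<s)

    splice-above : ∀ {v} → s + m ≤ v → v < x + m → ∃[ r ] splice (F.zero , r) ≡ v
    splice-above {v} s+m≤v v<x+m = fromℕ< v∸m<x ,
      trans (cong (skip s m) (FP.toℕ-fromℕ< v∸m<x)) (trans (skip-above m s≤v∸m) (m∸n+n≡m m≤v))
      where
      m≤v : m ≤ v
      m≤v = ≤-trans (m≤n+m m s) s+m≤v
      v∸m<x : v ∸ m < x
      v∸m<x = m≤n⇒n<m+o⇒n∸m<o m≤v (subst (v <_) (+-comm x m) v<x+m)
      s≤v∸m : s ≤ v ∸ m
      s≤v∸m = subst (_≤ v ∸ m) (m+n∸n≡m s m) (∸-monoˡ-≤ m s+m≤v)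

    splice-window : ∀ {v} → s ≤ v → v < s + m → ∃[ c ] ∃[ r ] splice (F.suc c , r) ≡ v
    splice-window {v} s≤v v<s+m with H.surjective (v ∸ s) (m≤n⇒n<m+o⇒n∸m<o s≤v v<s+m)
    ... | (c , r) , hu≡ = c , r , trans (cong (s +_) hu≡) (m+[n∸m]≡n s≤v)

    window-disjoint : ∀ r u → splice (F.zero , r) ≢ s + h u
    window-disjoint r u eq with skip-outside s m (toℕ r)
    ... | inj₁ below = contradiction (subst (_< s) eq below) (≤⇒≯ (m≤m+n s (h u)))
    ... | inj₂ above = contradiction (subst (s + m ≤_) eq above) (<⇒≱ (+-monoʳ-< s (H.bounded u)))

    splice-injective : Injective _≡_ _≡_ splice
    splice-injective {F.zero , r} {F.zero , r′} eq =
      cong (F.zero ,_) (FP.toℕ-injective (strictMono⇒injective (skip-mono-< s m) eq))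
    splice-injective {F.zero , r} {F.suc c′ , r′} eq = ⊥-elim (window-disjoint r (c′ , r′) eq)
    splice-injective {F.suc c , r} {F.zero , r′} eq = ⊥-elim (window-disjoint r′ (c , r) (sym eq))
    splice-injective {F.suc c , r} {F.suc c′ , r′} eq with H.injective (+-cancelˡ-≡ s _ _ eq)
    ... | refl = refl

    splice-linExt : IsLinExtD (x ∷ xs) splice
    splice-linExt = record
      { injective  = splice-injective
      ; bounded    = bounded
      ; surjective = surjective
      ; monotone   = monotone
      }
      where
      bounded : ∀ u → splice u < x + m
      bounded (F.zero , r) with skip-cases s m (toℕ r)
      ... | inj₁ (r<s , eq) = subst (_< x + m) (sym eq) (<-≤-trans (FP.toℕ<n r) (m≤m+n x m))
      ... | inj₂ (_ , eq)   = subst (_< x + m) (sym eq) (+-monoˡ-< m (FP.toℕ<n r))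
      bounded (F.suc c , r) = <-≤-trans (+-monoʳ-< s (H.bounded (c , r))) (+-monoˡ-≤ m s≤x)
      surjective : ∀ v → v < x + m → ∃[ u ] splice u ≡ v
      surjective v v<x+m with v <? s | v <? s + m
      ... | yes v<s | _         = let (r , eq) = splice-below v<s in (F.zero , r) , eq
      ... | no v≮s  | yes v<s+m = let (c , r , eq) = splice-window (≮⇒≥ v≮s) v<s+m in (F.suc c , r) , eq
      ... | no _    | no v≮s+m  = let (r , eq) = splice-above (≮⇒≥ v≮s+m) v<x+m in (F.zero , r) , eq
      monotone : ∀ u v → u ≺D v → splice u < splice v
      monotone (F.zero , r)  (F.zero , r′)  (refl , r<r′) = skip-mono-< s m r<r′
      monotone (F.suc c , r) (F.suc c , r′) (refl , r<r′) = +-monoʳ-< s (H.monotone (c , r) (c , r′) (refl , r<r′))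

open Splice using (splice; splice-below; splice-above; splice-window; splice-linExt)

stacked : ∀ {ℓ} (lam : Vec ℕ ℓ) → DElt lam → ℕ
stacked []       (() , _)
stacked (x ∷ xs) = splice x x (stacked xs)

stacked-linExt : ∀ {ℓ} (lam : Vec ℕ ℓ) → IsLinExtD lam (stacked lam)
stacked-linExt [] = record
  { injective = λ { {() , _} } ; bounded = λ { (() , _) } ; surjective = λ _ () ; monotone = λ { (() , _) } }
stacked-linExt (x ∷ xs) = splice-linExt x x (stacked xs) ≤-refl (stacked-linExt xs)

Separates : ∀ {ℓ} (lam : Vec ℕ ℓ) → ℕ → ℕ → Set
Separates lam a b = ∃[ g ] IsLinExtD lam g ×
  ∃[ u ] ∃[ v ] DElt.chain u ≢ DElt.chain v × g u ≡ a × g v ≡ b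

Separates-sym : ∀ {ℓ} {lam : Vec ℕ ℓ} {a b} → Separates lam a b → Separates lam b a
Separates-sym (g , G , u , v , chains≢ , gu , gv) = g , G , v , u , chains≢ ∘ sym , gv , gu

lift-separation : ∀ {ℓ} x {xs : Vec ℕ ℓ} {a b} → Separates xs a b → Separates (x ∷ xs) (x + a) (x + b)
lift-separation x {xs} (g , G , (c , r) , (c′ , r′) , c≢c′ , ga , gb) =
  splice x x g , splice-linExt x x g ≤-refl G ,
  (F.suc c , r) , (F.suc c′ , r′) , c≢c′ ∘ FP.suc-injective , cong (x +_) ga , cong (x +_) gb

module _ {ℓ} (x : ℕ) (xs : Vec ℕ ℓ) where
  private
    m : ℕ
    m = sum xs
    h : DElt xs → ℕ
    h = stacked xs
    H : IsLinExtD xs h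
    H = stacked-linExt xs

  separated-by-window : ∀ {s a b} → s ≤ x → a < x + m → a < s ⊎ s + m ≤ a → s ≤ b → b < s + m →
                        Separates (x ∷ xs) a b
  separated-by-window {s} {a} {b} s≤x a<x+m a∉window s≤b b<s+m =
    let (r , ea) = outside ; (c , r′ , eb) = splice-window x s h s≤x H s≤b b<s+m
    in splice x s h , splice-linExt x s h s≤x H , (F.zero , r) , (F.suc c , r′) , (λ ()) , ea , eb
    where
    outside : ∃[ r ] splice x s h (F.zero , r) ≡ a
    outside = [ splice-below x s h s≤x H , (λ s+m≤a → splice-above x s h s≤x H s+m≤a a<x+m) ]′ a∉window

AllSeparated : ∀ {ℓ} → Vec ℕ ℓ → Set
AllSeparated {ℓ} lam = IsDPartition (sum lam) ℓ lam → ∀ {a b} → a < b → b < sum lam → Separates lam a b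

separates-in-tail : ∀ {ℓ} {n x y} {zs : Vec ℕ ℓ} → IsDPartition n (suc (suc ℓ)) (x ∷ y ∷ zs) →
  AllSeparated (y ∷ zs) → ∀ {a b} → x ≤ a → a < b → b < sum (y ∷ zs) → Separates (x ∷ y ∷ zs) a b
separates-in-tail {zs = []} (_ , _ , dec , _) _ x≤a a<b b<y =
  contradiction (≤-trans (dec F.zero (F.suc F.zero) z≤n) x≤a)
                (<⇒≱ (<-trans a<b (subst (_ <_) (+-identityʳ _) b<y)))
separates-in-tail {x = x} {y} {z ∷ zs} (_ , pos , dec , _) separates-tail {a} {b} x≤a a<b b<m =
  subst₂ (Separates _) (m+[n∸m]≡n x≤a) (m+[n∸m]≡n (<⇒≤ (≤-<-trans x≤a a<b)))
    (lift-separation x (separates-tail tail (∸-monoˡ-< a<b x≤a) (≤-<-trans (m∸n≤m b x) b<m)))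
  where
  tail : IsDPartition (sum (y ∷ z ∷ zs)) _ (y ∷ z ∷ zs)
  tail = s≤s (s≤s z≤n) , (λ c → pos (F.suc c)) ,
         (λ c c′ c≤c′ → dec (F.suc c) (F.suc c′) (s≤s c≤c′)) , refl

-- Splicing the stacked tail into chain 0 leaves a window of length m = sum xs;
-- choosing its start s puts exactly one of a, b into it unless x ≤ a < b < m,
-- which is handled on the tail (and cannot occur for ℓ = 2, where m ≤ x).
separates-step : ∀ {ℓ} {n x y} {zs : Vec ℕ ℓ} → IsDPartition n (suc (suc ℓ)) (x ∷ y ∷ zs) →
  AllSeparated (y ∷ zs) → ∀ {a b} → a < b → b < n → Separates (x ∷ y ∷ zs) a b
separates-step {x = x} {y} {zs} D@(_ , pos , _ , refl) separates-tail {a} {b} a<b b<n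
  with a <? x | b <? suc a + sum (y ∷ zs) | sum (y ∷ zs) ≤? b
... | yes a<x | yes b<a+1+m | _ =
  separated-by-window x (y ∷ zs) a<x (<-trans a<b b<n) (inj₁ (n<1+n a)) a<b b<a+1+m
... | yes a<x | no b≮a+1+m | _ =
  Separates-sym (separated-by-window x (y ∷ zs) (<⇒≤ a<x) b<n (inj₂ (<⇒≤ (≮⇒≥ b≮a+1+m))) ≤-refl
                  (m<m+n a (≤-trans (pos (F.suc F.zero)) (m≤m+n y (sum zs)))))
... | no a≮x | _ | yes m≤b =
  Separates-sym (separated-by-window x (y ∷ zs) (m≤n+o⇒m∸o≤n b x _ (<⇒≤ b<n)) b<n
                  (inj₂ (≤-reflexive (m∸n+n≡m m≤b)))
                  (m≤n+o⇒m∸o≤n b a _ (≤-trans (<⇒≤ b<n) (+-monoˡ-≤ _ (≮⇒≥ a≮x))))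
                  (subst (a <_) (sym (m∸n+n≡m m≤b)) a<b))
... | no a≮x | _ | no b≱m = separates-in-tail D separates-tail (≮⇒≥ a≮x) a<b (≰⇒> b≱m)

separates : ∀ {n ℓ} {lam : Vec ℕ ℓ} → IsDPartition n ℓ lam →
            ∀ {a b} → a < b → b < n → Separates lam a b
separates {lam = []}         (() , _)
separates {lam = x ∷ []}     (s≤s () , _)
separates {lam = x ∷ y ∷ zs} D = separates-step D separates

separates-≢ : ∀ {n ℓ} {lam : Vec ℕ ℓ} → IsDPartition n ℓ lam →
              ∀ {a b} → a ≢ b → a < n → b < n → Separates lam a b
separates-≢ D {a} {b} a≢b a<n b<n with <-cmp a b
... | tri< a<b _ _ = separates D a<b b<n
... | tri≈ _ a≡b _ = contradiction a≡b a≢b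
... | tri> _ _ b<a = Separates-sym (separates D b<a a<n)

-- Bender–Knuth involutions preserve injective order-preserving labellings

module BKProperties {A : Set} (elems : List A) {_≺_ : Rel A 0ℓ} (_≺?_ : Decidable _≺_) where
  open BK elems _≺?_

  record IsMonoInjection (f : A → ℕ) : Set where
    field
      injective : Injective _≡_ _≡_ f
      monotone  : ∀ x y → x ≺ y → f x < f y

  linExt⇒monoInjection : ∀ {N f} → IsLinExt N f → IsMonoInjection f
  linExt⇒monoInjection (inj , _ , _ , mono) = record { injective = inj _ _ ; monotone = mono }

  linExt₀⇒linExt : ∀ {N h} → IsLinExt₀ _≺_ N h → IsLinExt N (suc ∘ h)
  linExt₀⇒linExt {N} {h} L =
    (λ x y eq → L.injective (suc-injective eq)) ,
    (λ x → s≤s z≤n , L.bounded x) ,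
    surjective ,
    (λ x y x≺y → s≤s (L.monotone x y x≺y))
    where
    module L = IsLinExt₀ L
    surjective : ∀ m → 1 ≤ m → m ≤ N → ∃[ x ] suc (h x) ≡ m
    surjective (suc m) _ m<N = let (x , hx≡m) = L.surjective m m<N in x , cong suc hx≡m

  inv-sound : ∀ f k {a} → inv f k ≡ just a → f a ≡ k
  inv-sound f k = go elems
    where
    go : ∀ xs {a} → BK.inv xs _≺?_ f k ≡ just a → f a ≡ k
    go (x ∷ xs) eq with f x ≟ k
    go (x ∷ xs) refl | yes fx≡k = fx≡k
    go (x ∷ xs) eq   | no _     = go xs eq

  -- t i f x reduces to relabel (swappable f i) i (f x)
  relabel : Bool → ℕ → ℕ → ℕ
  relabel b i v =
    if ⌊ v ≟ i ⌋ then (if b then suc i else v)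
    else if ⌊ v ≟ suc i ⌋ then (if b then i else v) else v

  relabel-false : ∀ i v → relabel false i v ≡ v
  relabel-false i v with v ≟ i
  ... | yes _ = refl
  ... | no  _ with v ≟ suc i
  ...   | yes _ = refl
  ...   | no  _ = refl

  data TranspositionView (i v : ℕ) : ℕ → Set where
    at-i    : v ≡ i → TranspositionView i v (suc i)
    at-suc-i : v ≡ suc i → TranspositionView i v i
    elsewhere : v ≢ i → v ≢ suc i → TranspositionView i v v

  transposition-view : ∀ i v → TranspositionView i v (relabel true i v)
  transposition-view i v with v ≟ i
  ... | yes v≡i = at-i v≡i
  ... | no  v≢i with v ≟ suc i
  ...   | yes v≡1+i = at-suc-i v≡1+i
  ...   | no  v≢1+i = elsewhere v≢i v≢1+i

  transposition-injective : ∀ i u v → relabel true i u ≡ relabel true i v → u ≡ v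
  transposition-injective i u v eq
    with relabel true i u | transposition-view i u | relabel true i v | transposition-view i v
  ... | _ | at-i u≡i          | _ | at-i v≡i          = trans u≡i (sym v≡i)
  ... | _ | at-i _            | _ | at-suc-i _        = contradiction eq (1+n≢n)
  ... | _ | at-i _            | _ | elsewhere _ v≢1+i = contradiction (sym eq) v≢1+i
  ... | _ | at-suc-i _        | _ | at-i _            = contradiction (sym eq) (1+n≢n)
  ... | _ | at-suc-i u≡1+i    | _ | at-suc-i v≡1+i    = trans u≡1+i (sym v≡1+i)
  ... | _ | at-suc-i _        | _ | elsewhere v≢i _   = contradiction (sym eq) v≢i
  ... | _ | elsewhere _ u≢1+i | _ | at-i _            = contradiction eq u≢1+i
  ... | _ | elsewhere u≢i _   | _ | at-suc-i _        = contradiction eq u≢i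
  ... | _ | elsewhere _ _     | _ | elsewhere _ _     = eq

  transposition-mono : ∀ i u v → u < v → ¬ (u ≡ i × v ≡ suc i) → relabel true i u < relabel true i v
  transposition-mono i u v u<v not-pair
    with relabel true i u | transposition-view i u | relabel true i v | transposition-view i v
  ... | _ | at-i u≡i          | _ | at-i v≡i          = contradiction (trans u≡i (sym v≡i)) (<⇒≢ u<v)
  ... | _ | at-i u≡i          | _ | at-suc-i v≡1+i    = contradiction (u≡i , v≡1+i) not-pair
  ... | _ | at-i u≡i          | _ | elsewhere _ v≢1+i =
    ≤∧≢⇒< (subst (λ z → suc z ≤ v) u≡i u<v) (v≢1+i ∘ sym)
  ... | _ | at-suc-i u≡1+i    | _ | at-i v≡i          =
    contradiction (subst₂ _<_ u≡1+i v≡i u<v) (<-asym (n<1+n i))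
  ... | _ | at-suc-i u≡1+i    | _ | at-suc-i v≡1+i    = contradiction (trans u≡1+i (sym v≡1+i)) (<⇒≢ u<v)
  ... | _ | at-suc-i u≡1+i    | _ | elsewhere _ _     = <-trans (n<1+n i) (subst (_< v) u≡1+i u<v)
  ... | _ | elsewhere _ _     | _ | at-i v≡i          = <-trans (subst (u <_) v≡i u<v) (n<1+n i)
  ... | _ | elsewhere u≢i _   | _ | at-suc-i v≡1+i    = ≤∧≢⇒< (≤-pred (subst (u <_) v≡1+i u<v)) u≢i
  ... | _ | elsewhere _ _     | _ | elsewhere _ _     = u<v

  swappable⇒incomparable : ∀ {f} → Injective _≡_ _≡_ f → ∀ i {x y} →
                           swappable f i ≡ true → f x ≡ i → f y ≡ suc i → ¬ x ≺ y
  swappable⇒incomparable {f} f-inj i {x} {y} sw fx≡i fy≡1+i x≺y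
    with inv f i in inv-i | inv f (suc i) in inv-1+i | sw
  ... | nothing | _       | ()
  ... | just _  | nothing | ()
  ... | just a  | just b  | sw′
    with f-inj (trans (inv-sound f i inv-i) (sym fx≡i))
       | f-inj (trans (inv-sound f (suc i) inv-1+i) (sym fy≡1+i))
  ...   | refl | refl with a ≺? b
  ...     | yes _ = contradiction sw′ λ ()
  ...     | no a⊀b = a⊀b x≺y

  t-monoInjection : ∀ i {f} → IsMonoInjection f → IsMonoInjection (t i f)
  t-monoInjection i {f} M with swappable f i in sw
  ... | false = record
    { injective = λ {x} {y} eq → M.injective (subst₂ _≡_ (relabel-false i (f x)) (relabel-false i (f y)) eq)
    ; monotone  = λ x y x≺y → subst₂ _<_ (sym (relabel-false i (f x))) (sym (relabel-false i (f y)))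
                                         (M.monotone x y x≺y)
    }
    where module M = IsMonoInjection M
  ... | true = record
    { injective = λ {x} {y} eq → M.injective (transposition-injective i (f x) (f y) eq)
    ; monotone  = λ x y x≺y → transposition-mono i (f x) (f y) (M.monotone x y x≺y)
                    λ (fx≡i , fy≡1+i) → swappable⇒incomparable M.injective i sw fx≡i fy≡1+i x≺y
    }
    where module M = IsMonoInjection M

  tdown-monoInjection : ∀ i {f} → IsMonoInjection f → IsMonoInjection (tdown i f)
  tdown-monoInjection zero    M = M
  tdown-monoInjection (suc i) M = t-monoInjection (suc i) (tdown-monoInjection i M)

  q-monoInjection : ∀ i {f} → IsMonoInjection f → IsMonoInjection (q i f)
  q-monoInjection zero    M = M
  q-monoInjection (suc i) M = q-monoInjection i (tdown-monoInjection (suc i) M)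

  qq-monoInjection : ∀ j k {f} → IsMonoInjection f → IsMonoInjection (qq j k f)
  qq-monoInjection j k M = q-monoInjection (k ∸ 1) (q-monoInjection (k ∸ j) (q-monoInjection (k ∸ 1) M))

  [t∘qq]²-monoInjection : ∀ i j k {f} → IsMonoInjection f → IsMonoInjection ((t i ∘ qq j k ∘ t i ∘ qq j k) f)
  [t∘qq]²-monoInjection i j k M = t-monoInjection i (qq-monoInjection j k (t-monoInjection i (qq-monoInjection j k M)))

-- Linear extensions of R = P ⊕ D_λ ⊕ Q

module LinExtR {p q ℓ : ℕ} {lam : Vec ℕ ℓ}
  {_<P_ : Rel (Fin p) 0ℓ} (Pp : IsDecStrictPartialOrder _≡_ _<P_)
  {_<Q_ : Rel (Fin q) 0ℓ} (Qp : IsDecStrictPartialOrder _≡_ _<Q_) where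

  open Rposet {lam = lam} Pp Qp using (R; _<R_; _<R?_; elemsR; IsLinExt; I)
  open BKProperties elemsR _<R?_ using (linExt₀⇒linExt)

  -- pigeonhole: the p labels of P lie below, the q labels of Q above, every label of D_λ
  D-label-bounds : ∀ {n f} → IsLinExt (p + n + q) f → ∀ c r → p < f (inD c r) × f (inD c r) ≤ p + n
  D-label-bounds {n} {f} (f-inj , f-range , _ , f-mono) c r = p<fx , fx≤p+n
    where
    x : R
    x = inD c r
    p<fx : 1 + p ≤ f x
    p<fx = injective⇒≤-interval (f ∘ inP) (proj₁ (f-range x))
             (inP-injective ∘ f-inj _ _)
             (λ a → proj₁ (f-range (inP a))) (λ a → f-mono (inP a) x tt)
      where
      inP-injective : ∀ {a b} → inP {ℓ = ℓ} {lam} a ≡ inP b → a ≡ b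
      inP-injective refl = refl
    fx≤p+n : f x ≤ p + n
    fx≤p+n = +-cancelʳ-≤ q (f x) (p + n) (≤-pred
      (injective⇒≤-interval (f ∘ inQ) (s≤s (proj₂ (f-range x)))
         (inQ-injective ∘ f-inj _ _)
         (λ b → f-mono x (inQ b) tt) (λ b → s≤s (proj₂ (f-range (inQ b))))))
      where
      inQ-injective : ∀ {a b} → inQ {ℓ = ℓ} {lam} a ≡ inQ b → a ≡ b
      inQ-injective refl = refl

  module OrdinalSum {hP : Fin p → ℕ} {hD : DElt lam → ℕ} {hQ : Fin q → ℕ}
    (LP : IsLinExt₀ _<P_ p hP) (LD : IsLinExtD lam hD) (LQ : IsLinExt₀ _<Q_ q hQ) where

    private
      module LP = IsLinExt₀ LP
      module LD = IsLinExt₀ LD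
      module LQ = IsLinExt₀ LQ
      n : ℕ
      n = sum lam

    ordinalSum : R → ℕ
    ordinalSum (inP a)   = hP a
    ordinalSum (inD c r) = p + hD (c , r)
    ordinalSum (inQ b)   = p + n + hQ b

    private
      P<D : ∀ a u → hP a < p + hD u
      P<D a u = <-≤-trans (LP.bounded a) (m≤m+n p (hD u))
      D<Q : ∀ u b → p + hD u < p + n + hQ b
      D<Q u b = <-≤-trans (+-monoʳ-< p (LD.bounded u)) (m≤m+n (p + n) (hQ b))
      P<Q : ∀ a b → hP a < p + n + hQ b
      P<Q a b = <-≤-trans (LP.bounded a) (≤-trans (m≤m+n p n) (m≤m+n (p + n) (hQ b)))

    ordinalSum-mono : ∀ x y → x <R y → ordinalSum x < ordinalSum y
    ordinalSum-mono (inP a)   (inP b)    a<b           = LP.monotone a b a<b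
    ordinalSum-mono (inP a)   (inD c r)  _             = P<D a (c , r)
    ordinalSum-mono (inP a)   (inQ b)    _             = P<Q a b
    ordinalSum-mono (inD c r) (inD c r′) (refl , r<r′) = +-monoʳ-< p (LD.monotone (c , r) (c , r′) (refl , r<r′))
    ordinalSum-mono (inD c r) (inQ b)    _             = D<Q (c , r) b
    ordinalSum-mono (inQ a)   (inQ b)    a<b           = +-monoʳ-< (p + n) (LQ.monotone a b a<b)

    ordinalSum-injective : Injective _≡_ _≡_ ordinalSum
    ordinalSum-injective {inP a}   {inP b}     eq = cong inP (LP.injective eq)
    ordinalSum-injective {inD c r} {inD c′ r′} eq with LD.injective (+-cancelˡ-≡ p _ _ eq)
    ... | refl = refl
    ordinalSum-injective {inQ a}   {inQ b}     eq = cong inQ (LQ.injective (+-cancelˡ-≡ (p + n) _ _ eq))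
    ordinalSum-injective {inP a}   {inD c r}   eq = contradiction eq (<⇒≢ (P<D a (c , r)))
    ordinalSum-injective {inP a}   {inQ b}     eq = contradiction eq (<⇒≢ (P<Q a b))
    ordinalSum-injective {inD c r} {inQ b}     eq = contradiction eq (<⇒≢ (D<Q (c , r) b))
    ordinalSum-injective {inD c r} {inP a}     eq = contradiction (sym eq) (<⇒≢ (P<D a (c , r)))
    ordinalSum-injective {inQ b}   {inP a}     eq = contradiction (sym eq) (<⇒≢ (P<Q a b))
    ordinalSum-injective {inQ b}   {inD c r}   eq = contradiction (sym eq) (<⇒≢ (D<Q (c , r) b))

    ordinalSum-bounded : ∀ x → ordinalSum x < p + n + q
    ordinalSum-bounded (inP a)   = <-≤-trans (LP.bounded a) (≤-trans (m≤m+n p n) (m≤m+n (p + n) q))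
    ordinalSum-bounded (inD c r) = <-≤-trans (+-monoʳ-< p (LD.bounded (c , r))) (m≤m+n (p + n) q)
    ordinalSum-bounded (inQ b)   = +-monoʳ-< (p + n) (LQ.bounded b)

    ordinalSum-surjective : ∀ m → m < p + n + q → ∃[ x ] ordinalSum x ≡ m
    ordinalSum-surjective m m<N with m <? p | m <? p + n
    ... | yes m<p | _ = let (a , eq) = LP.surjective m m<p in inP a , eq
    ... | no m≮p | yes m<p+n =
      let ((c , r) , eq) = LD.surjective (m ∸ p) (m≤n⇒n<m+o⇒n∸m<o (≮⇒≥ m≮p) m<p+n)
      in inD c r , trans (cong (p +_) eq) (m+[n∸m]≡n (≮⇒≥ m≮p))
    ... | no _ | no m≮p+n =
      let (b , eq) = LQ.surjective (m ∸ (p + n)) (m≤n⇒n<m+o⇒n∸m<o (≮⇒≥ m≮p+n) m<N)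
      in inQ b , trans (cong (p + n +_) eq) (m+[n∸m]≡n (≮⇒≥ m≮p+n))

    ordinalSum-linExt : IsLinExt (p + n + q) (suc ∘ ordinalSum)
    ordinalSum-linExt = linExt₀⇒linExt record
      { injective = ordinalSum-injective ; bounded = ordinalSum-bounded
      ; surjective = ordinalSum-surjective ; monotone = ordinalSum-mono }

    I-ordinalSum : ∀ c r → I (suc ∘ ordinalSum) c r ≡ suc (hD (c , r))
    I-ordinalSum c r = trans (cong (_∸ p) (sym (+-suc p (hD (c , r))))) (m+n∸m≡n p (suc (hD (c , r))))

  separatingLinExt : ∀ {n} → IsDPartition n ℓ lam →
    ∀ {a b} → a ≢ b → 1 ≤ a → a ≤ n → 1 ≤ b → b ≤ n →
    ∃[ f ] IsLinExt (p + n + q) f × ∃[ c ] ∃[ r ] ∃[ c′ ] ∃[ r′ ] c ≢ c′ × I f c r ≡ a × I f c′ r′ ≡ b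
  separatingLinExt D@(_ , _ , _ , refl) {suc a} {suc b} 1+a≢1+b _ a<n _ b<n
    with separates-≢ D (1+a≢1+b ∘ cong suc) a<n b<n
  ... | g , G , (c , r) , (c′ , r′) , c≢c′ , ga , gb =
    suc ∘ ordinalSum , ordinalSum-linExt , c , r , c′ , r′ , c≢c′ ,
    trans (I-ordinalSum c r) (cong suc ga) , trans (I-ordinalSum c′ r′) (cong suc gb)
    where
    open OrdinalSum (proj₂ (linExt₀-exists Pp)) G (proj₂ (linExt₀-exists Qp))

  I-injective : ∀ {n f} → IsLinExt (p + n + q) f → ∀ {c r c′ r′} → I f c r ≡ I f c′ r′ → c ≡ c′
  I-injective L@(f-inj , _) {c} {r} {c′} {r′} eq
    with f-inj (inD c r) (inD c′ r′)
           (∸-cancelʳ-≡ (<⇒≤ (proj₁ (D-label-bounds L c r))) (<⇒≤ (proj₁ (D-label-bounds L c′ r′))) eq)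
  ... | refl = refl

  I-bounds : ∀ {n f} → IsLinExt (p + n + q) f → ∀ c r → 1 ≤ I f c r × I f c r ≤ n
  I-bounds {n} {f} L c r =
    m<n⇒0<n∸m (proj₁ (D-label-bounds L c r)) , m≤n+o⇒m∸n≤o (f (inD c r)) p (proj₂ (D-label-bounds L c r))

  module BlockPermutation {n} (Φ : (R → ℕ) → R → ℕ)
    (Φ-mono : ∀ f → IsLinExt (p + n + q) f → ∀ x y → x <R y → Φ f x < Φ f y)
    (w : ℕ → ℕ)
    (Φ-permutes-blocks : ∀ f → IsLinExt (p + n + q) f → ∀ c m →
                         block {lam = lam} (I (Φ f)) c m ⇔ image w (block {lam = lam} (I f) c) m) where

    Φ-fixes-D⇒w-fixed : IsDPartition n ℓ lam → (∀ m → 1 ≤ m → m ≤ n → 1 ≤ w m × w m ≤ n) →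
      (∀ f → IsLinExt (p + n + q) f → ∀ c r → Φ f (inD c r) ≡ f (inD c r)) →
      ∀ m → 1 ≤ m → m ≤ n → w m ≡ m
    Φ-fixes-D⇒w-fixed D w-bounds Φ-fixes m 1≤m m≤n = decidable-stable (w m ≟ m) λ wm≢m →
      let (1≤wm , wm≤n) = w-bounds m 1≤m m≤n
          (f , L , c , r , c′ , r′ , c≢c′ , Ifcr≡m , Ifc′r′≡wm) =
            separatingLinExt D (wm≢m ∘ sym) 1≤m m≤n 1≤wm wm≤n
          (r″ , IΦf≡wm) = Equivalence.from (Φ-permutes-blocks f L c (w m)) (m , (r , Ifcr≡m) , refl)
      in c≢c′ (I-injective L (trans (cong (_∸ p) (sym (Φ-fixes f L c r″))) (trans IΦf≡wm (sym Ifc′r′≡wm))))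

    w-fixed⇒Φ-fixes-D : (∀ m → 1 ≤ m → m ≤ n → w m ≡ m) →
      ∀ f → IsLinExt (p + n + q) f → ∀ c r → Φ f (inD c r) ≡ f (inD c r)
    w-fixed⇒Φ-fixes-D w-fixed f L@(_ , _ , _ , f-mono) c =
      λ r → ∸-cancelʳ-≡ (<⇒≤ (p<Φf r)) (<⇒≤ (proj₁ (D-label-bounds L c r)))
                        (increasing-image-unique Φf↑ f↑ same-blocks r)
      where
      same-blocks : ∀ m → block {lam = lam} (I (Φ f)) c m ⇔ block {lam = lam} (I f) c m
      same-blocks m = ⇔.trans (Φ-permutes-blocks f L c m)
        (image-of-fixed (λ m′ (r , Ifcr≡m′) → let (1≤ , ≤n) = I-bounds L c r in
                          w-fixed m′ (subst (1 ≤_) Ifcr≡m′ 1≤) (subst (_≤ n) Ifcr≡m′ ≤n)) m)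
      p<Φf : ∀ r → p < Φ f (inD c r)
      p<Φf r = let (r′ , Ifcr′≡) = Equivalence.to (same-blocks _) (r , refl) in
        m∸n≢0⇒n<m (>⇒≢ (subst (1 ≤_) Ifcr′≡ (proj₁ (I-bounds L c r′))))
      Φf↑ : StrictlyIncreasing (I (Φ f) c)
      Φf↑ {r} {r′} r<r′ = ∸-monoˡ-< (Φ-mono f L (inD c r) (inD c r′) (refl , r<r′)) (<⇒≤ (p<Φf r))
      f↑ : StrictlyIncreasing (I f c)
      f↑ {r} {r′} r<r′ =
        ∸-monoˡ-< (f-mono (inD c r) (inD c r′) (refl , r<r′)) (<⇒≤ (proj₁ (D-label-bounds L c r)))

lemma4p5 :
    (n p q : ℕ) → 2 ≤ n →
    {_<P_ : Rel (Fin p) 0ℓ} (Pp : IsDecStrictPartialOrder _≡_ _<P_) →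
    {_<Q_ : Rel (Fin q) 0ℓ} (Qp : IsDecStrictPartialOrder _≡_ _<Q_) →
    (ℓ : ℕ) (lam : Vec ℕ ℓ) → IsDPartition n ℓ lam →
    (i j k : ℕ) → 1 ≤ i → i + 1 < j → j < k → k ≤ p + n + q →
    (w : ℕ → ℕ) → IsPermOn n w →
    (∀ (f : RElt p q ℓ lam → ℕ) → Rposet.IsLinExt {lam = lam} Pp Qp (p + n + q) f →
       ∀ (c : Fin ℓ) (m : ℕ) →
         block {lam = lam} (Rposet.I {lam = lam} Pp Qp (Rposet.F {lam = lam} Pp Qp i j k f)) c m
           ⇔ image w (block {lam = lam} (Rposet.I {lam = lam} Pp Qp f) c) m) →
    ((∀ (f : RElt p q ℓ lam → ℕ) → Rposet.IsLinExt {lam = lam} Pp Qp (p + n + q) f →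
        ∀ (c : Fin ℓ) (r : Fin (lookup lam c)) →
          Rposet.F {lam = lam} Pp Qp i j k f (inD c r) ≡ f (inD c r))
     ⇔ (∀ m → 1 ≤ m → m ≤ n → w m ≡ m))
-- Only λ ∈ 𝔇_n, w({1, …, n}) ⊆ {1, …, n} and the fact that (t_i q_jk)² is a composite
-- of Bender–Knuth involutions are used.
lemma4p5 n p q _ Pp Qp ℓ lam D i j k _ _ _ _ w (w-bounds , _) F-permutes-blocks =
  mk⇔ (Φ-fixes-D⇒w-fixed D w-bounds) w-fixed⇒Φ-fixes-D
  where
  open Rposet {lam = lam} Pp Qp using (_<R_; _<R?_; elemsR; IsLinExt; F)
  open BKProperties elemsR _<R?_
  open LinExtR {lam = lam} Pp Qp
  F-mono : ∀ f → IsLinExt (p + n + q) f → ∀ x y → x <R y → F i j k f x < F i j k f y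
  F-mono f L = IsMonoInjection.monotone ([t∘qq]²-monoInjection i j k (linExt⇒monoInjection L))
  open BlockPermutation (F i j k) F-mono w F-permutes-blocks
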